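{- Let $\mathcal{M}_O=(\mathcal{U},\mathcal{I})$ be a matroid on a finite ground set, and for each $e\in\mathcal{U}$ let $X_e$ be a random variable with known distribution on $\{0,1,\dots,m\}$, the $X_e$ mutually independent; fix a threshold $t$. Let $G(\mathcal{M}_O)=\mathrm{MGreedy}(\mathcal{U},\mathcal{I},t)$. Then for every positive integer $i$, $$\Pr[\mathrm{rank}_t(G(\mathcal{M}_O))\ge i]\ge\max_{\pi}\Pr[\mathrm{rank}_t(S^{(\pi)})\ge i],$$ the maximum being over all adaptive policies $\pi$ whose selection set $S^{(\pi)}$ is always in $\mathcal{I}$.
   Context: An adaptive policy selects elements one at a time; immediately after an element $e$ is selected, the realized value of $X_e$ is revealed, and subsequent choices (including stopping) may depend on all values revealed so far; $S^{(\pi)}$ is its (random) selection set. $\mathrm{rank}_t(S)=|\{e\in S:X_e\le t\}|$. $\mathrm{MGreedy}(\mathcal{U},\mathcal{I},t)$ is the (non-adaptive) matroid greedy algorithm with weights $\Pr[X_e\le t]$: starting from $S=\emptyset$, while some $e\in\mathcal{U}\setminus S$ has $S\cup\{e\}\in\mathcal{I}$, add to $S$ such an element maximizing $\Pr[X_e\le t]$; output $S$.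
   Formalization: The distributions of the random variables $X_e$ assign rational probabilities to the values in $\{0,1,\dots,m\}$ rather than real ones. -}

module Defs where

open import Data.Nat using (ℕ; zero; suc; _<_; _≤ᵇ_)
import Data.Nat as ℕ
open import Data.Bool using (Bool; true; false; if_then_else_; _∧_)
open import Data.Fin using (Fin; toℕ) renaming (zero to fzero; suc to fsuc)
open import Data.Fin.Subset using (Subset; _∈_; _∉_; _⊆_; _∪_; ⁅_⁆; ∣_∣)
  renaming (⊥ to ∅)
open import Data.Vec using (lookup)
open import Data.Product using (Σ; _×_; ∃)
open import Data.Rational using (ℚ; 0ℚ; 1ℚ; _+_; _*_; _≤_)
open import Data.Empty using (⊥)
open import Relation.Binary.PropositionalEquality using (_≡_)

-- ground set U = Fin n; values of X_e lie in {0,…,m} = Fin (suc m)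

record IsMatroid {n : ℕ} (I : Subset n → Set) : Set where
  field
    empty-indep : I ∅
    hereditary  : ∀ (A B : Subset n) → A ⊆ B → I B → I A
    exchange    : ∀ (A B : Subset n) → I A → I B → ∣ A ∣ < ∣ B ∣ →
                  ∃ λ e → e ∈ B × e ∉ A × I (A ∪ ⁅ e ⁆)

sumFin : ∀ (k : ℕ) → (Fin k → ℚ) → ℚ
sumFin zero    f = 0ℚ
sumFin (suc k) f = f fzero + sumFin k (λ j → f (fsuc j))

sumFinℕ : ∀ (k : ℕ) → (Fin k → ℕ) → ℕ
sumFinℕ zero    f = 0
sumFinℕ (suc k) f = f fzero ℕ.+ sumFinℕ k (λ j → f (fsuc j))

-- a realization of all the X_e
Outcome : ℕ → ℕ → Set
Outcome n m = Fin n → Fin (suc m)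

-- expectation of f under the product distribution with marginals p e
-- (this encodes mutual independence of the X_e)
Expect : ∀ {n m : ℕ} → (Fin n → Fin (suc m) → ℚ) → (Outcome n m → ℚ) → ℚ
Expect {zero}  {m} p f = f (λ ())
Expect {suc n} {m} p f =
  sumFin (suc m) (λ v → p fzero v * Expect (λ e → p (fsuc e))
    (λ x → f (λ { fzero → v ; (fsuc e) → x e })))

Pr : ∀ {n m : ℕ} → (Fin n → Fin (suc m) → ℚ) → (Outcome n m → Bool) → ℚ
Pr p A = Expect p (λ x → if A x then 1ℚ else 0ℚ)

IsDistributions : ∀ {n m : ℕ} → (Fin n → Fin (suc m) → ℚ) → Set
IsDistributions {n} {m} p =
  (∀ e v → 0ℚ ≤ p e v) × (∀ e → sumFin (suc m) (p e) ≡ 1ℚ)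

probLe : ∀ {n m : ℕ} → (Fin n → Fin (suc m) → ℚ) → ℕ → Fin n → ℚ
probLe {n} {m} p t e = sumFin (suc m) (λ v → if toℕ v ≤ᵇ t then p e v else 0ℚ)

rankT : ∀ {n m : ℕ} → ℕ → Outcome n m → Subset n → ℕ
rankT {n} t x S = sumFinℕ n (λ e → if lookup S e ∧ (toℕ (x e) ≤ᵇ t) then 1 else 0)

-- MGreedy with weights w: `Greedy I w S G` means: running the greedy loop from
-- current set S can (for some tie-breaking) terminate with output G.
data Greedy {n : ℕ} (I : Subset n → Set) (w : Fin n → ℚ) : Subset n → Subset n → Set where
  done : ∀ {S} → (∀ e → e ∉ S → I (S ∪ ⁅ e ⁆) → ⊥) → Greedy I w S S
  step : ∀ {S G} e → e ∉ S → I (S ∪ ⁅ e ⁆) →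
         (∀ f → f ∉ S → I (S ∪ ⁅ f ⁆) → w f ≤ w e) →
         Greedy I w (S ∪ ⁅ e ⁆) G → Greedy I w S G

-- adaptive policies: decision trees; after picking e the value of X_e is
-- revealed and the continuation may depend on it
data Policy (n m : ℕ) : Set where
  stop : Policy n m
  pick : Fin n → (Fin (suc m) → Policy n m) → Policy n m

run : ∀ {n m : ℕ} → Policy n m → Outcome n m → Subset n
run stop       x = ∅
run (pick e k) x = ⁅ e ⁆ ∪ run (k (x e)) x

module Submission where

-- Let q e = Pr[X_e ≤ t]. By the exchange property, the greedy weights dominate, threshold by
-- threshold, the q-weights of every independent set, and Pr[rank_t(G) ≥ i] is the tail
-- Pr[Bernoulli(b₁) + … + Bernoulli(b_k) ≥ i] of the greedy weights b₁, …, b_k. An adaptive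
-- policy is handled by induction on its decision tree, carrying a list B of greedy weights that
-- still dominates every independent extension of the elements picked so far: a fresh pick e is
-- charged to the least b ∈ B with q e ≤ b, removing b keeps the invariant, and since the tail is
-- increasing in each success probability, the policy never beats the tail of B.

open import Defs
open import Data.Nat using (ℕ; zero; suc; z≤n; _≤ᵇ_) renaming (_≤_ to _≤ℕ_; _+_ to _+ℕ_)
import Data.Nat.Properties as ℕP
open import Data.Bool using (Bool; true; false; if_then_else_; _∧_; _∨_; not)
open import Data.Bool.Properties using (∧-zeroʳ; ∨-identityʳ)
open import Data.Fin using (Fin; zero; suc; toℕ; _≟_)
open import Data.Fin.Properties using (suc-injective)
open import Data.Fin.Subset using (Subset; _∈_; _∉_; _⊆_; _∪_; ⁅_⁆; ∣_∣) renaming (⊥ to ∅)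
open import Data.Fin.Subset.Properties
  using (_∈?_; ∉⊥; x∈⁅x⁆; x≢y⇒x∉⁅y⁆; p⊆p∪q; q⊆p∪q; x∈p∪q⁺; x∈p∪q⁻; ∪-assoc; ∪-identityˡ; ∪-identityʳ; ∣⊥∣≡0)
open import Data.Vec using ([]; _∷_; lookup; tabulate)
open import Data.Vec.Properties using (lookup-zipWith; lookup∘tabulate; []=⇒lookup; lookup⇒[]=)
open import Data.Vec.Functional using (updateAt) renaming (_∷_ to _∷ᶠ_)
open import Data.Vec.Functional.Properties using (updateAt-updates; updateAt-minimal)
open import Data.Rational using (ℚ; 0ℚ; 1ℚ; _+_; _*_; _-_; -_; _≤_; _≤?_)
open import Data.Rational.Base using (nonNegative)
import Data.Rational.Properties as ℚP
open import Data.Rational.Solver using (module +-*-Solver)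
open import Data.List using (List; []; _∷_; _++_; map)
open import Data.List.Relation.Unary.All as All using (All; []; _∷_; universal)
open import Data.List.Relation.Unary.All.Properties using (++⁺; ++⁻; ++⁻ˡ; ++⁻ʳ; map⁺)
open import Data.Product using (Σ-syntax; _×_; _,_; proj₁; proj₂)
open import Data.Sum using (_⊎_; inj₁; inj₂; [_,_]′)
open import Function using (_∘_; const; mk⇔)
open import Relation.Nullary using (Dec; does; yes; no; ¬_; contradiction)
open import Relation.Nullary.Decidable using (dec-true; dec-false; does-⇔)
open import Relation.Binary.PropositionalEquality
open import Algebra.Bundles using (CommutativeMonoid)
open import Algebra.Properties.CommutativeSemigroup ℕP.+-commutativeSemigroup using (x∙yz≈y∙xz)
open import Algebra.Properties.CommutativeSemigroup
  (CommutativeMonoid.commutativeSemigroup ℚP.+-0-commutativeMonoid) using () renaming (interchange to +-interchange)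
open import Algebra.Properties.CommutativeSemigroup
  (CommutativeMonoid.commutativeSemigroup ℚP.*-1-commutativeMonoid) using () renaming (x∙yz≈y∙xz to *-exchange)

open +-*-Solver using (solve; _:=_; _:+_; _:-_; _:*_; con)

∉⇒lookup≡false : ∀ {n} {d : Fin n} {S} → d ∉ S → lookup S d ≡ false
∉⇒lookup≡false {d = d} {S} d∉S with lookup S d in eq
... | true  = contradiction (lookup⇒[]= d S eq) d∉S
... | false = refl

lookup-∅ : ∀ {n} (d : Fin n) → lookup ∅ d ≡ false
lookup-∅ {n} d = ∉⇒lookup≡false {S = ∅ {n}} ∉⊥

lookup-∪ : ∀ {n} (p q : Subset n) d → lookup (p ∪ q) d ≡ (lookup p d ∨ lookup q d)
lookup-∪ p q d = lookup-zipWith _∨_ d p q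

lookup-⁅⁆-other : ∀ {n} {d e : Fin n} → d ≢ e → lookup ⁅ e ⁆ d ≡ false
lookup-⁅⁆-other d≢e = ∉⇒lookup≡false (x≢y⇒x∉⁅y⁆ d≢e)

lookup-∪⁅⁆-self : ∀ {n} (A : Subset n) e → lookup (A ∪ ⁅ e ⁆) e ≡ true
lookup-∪⁅⁆-self A e = []=⇒lookup (x∈p∪q⁺ {p = A} (inj₂ (x∈⁅x⁆ e)))

lookup-∪⁅⁆-other : ∀ {n} (A : Subset n) {d e} → d ≢ e → lookup (A ∪ ⁅ e ⁆) d ≡ lookup A d
lookup-∪⁅⁆-other A {d} {e} d≢e =
  trans (lookup-∪ A ⁅ e ⁆ d) (trans (cong (lookup A d ∨_) (lookup-⁅⁆-other d≢e)) (∨-identityʳ (lookup A d)))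

lookup-⁅⁆∪-self : ∀ {n} e (R : Subset n) → lookup (⁅ e ⁆ ∪ R) e ≡ true
lookup-⁅⁆∪-self e R = []=⇒lookup (x∈p∪q⁺ {q = R} (inj₁ (x∈⁅x⁆ e)))

lookup-⁅⁆∪-other : ∀ {n} {d e} (R : Subset n) → d ≢ e → lookup (⁅ e ⁆ ∪ R) d ≡ lookup R d
lookup-⁅⁆∪-other {d = d} {e} R d≢e = trans (lookup-∪ ⁅ e ⁆ R d) (cong (_∨ lookup R d) (lookup-⁅⁆-other d≢e))

∪-monoʳ-⊆ : ∀ {n} (A : Subset n) {X Y} → X ⊆ Y → A ∪ X ⊆ A ∪ Y
∪-monoʳ-⊆ A {X} {Y} X⊆Y x∈ = [ p⊆p∪q Y , q⊆p∪q A Y ∘ X⊆Y ]′ (x∈p∪q⁻ A X x∈)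

ind : Bool → ℕ
ind b = if b then 1 else 0

count : ∀ {n} → (Fin n → Bool) → ℕ
count {n} f = sumFinℕ n (λ d → ind (f d))

count-cong : ∀ {n} {f g : Fin n → Bool} → (∀ d → f d ≡ g d) → count f ≡ count g
count-cong {zero}  f≗g = refl
count-cong {suc n} f≗g = cong₂ _+ℕ_ (cong ind (f≗g zero)) (count-cong (f≗g ∘ suc))

count-mono : ∀ {n} {f g : Fin n → Bool} → (∀ d → f d ≡ true → g d ≡ true) → count f ≤ℕ count g
count-mono {zero}  f⇒g = z≤n
count-mono {suc n} {f} f⇒g = ℕP.+-mono-≤ (ind-mono (f zero) (f⇒g zero)) (count-mono (f⇒g ∘ suc))
  where
  ind-mono : ∀ a {b} → (a ≡ true → b ≡ true) → ind a ≤ℕ ind b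
  ind-mono false a⇒b = z≤n
  ind-mono true  a⇒b rewrite a⇒b refl = ℕP.≤-refl

count-false : ∀ {n} → count {n} (λ _ → false) ≡ 0
count-false {zero}  = refl
count-false {suc n} = count-false {n}

count-insert : ∀ {n} (e : Fin n) {f g : Fin n → Bool} → g e ≡ false →
               (∀ d → d ≢ e → f d ≡ g d) → count f ≡ ind (f e) +ℕ count g
count-insert {suc n} zero {f} {g} g0 f≗g = cong₂ _+ℕ_ refl (begin
  count (f ∘ suc)              ≡⟨ count-cong (λ d → f≗g (suc d) (λ ())) ⟩
  count (g ∘ suc)              ≡⟨ cong (λ b → ind b +ℕ count (g ∘ suc)) (sym g0) ⟩
  count g                      ∎)
  where open ≡-Reasoning
count-insert {suc n} (suc e) {f} {g} ge f≗g = begin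
  ind (f zero) +ℕ count (f ∘ suc)
    ≡⟨ cong (ind (f zero) +ℕ_) (count-insert e ge (λ d d≢e → f≗g (suc d) (d≢e ∘ suc-injective))) ⟩
  ind (f zero) +ℕ (ind (f (suc e)) +ℕ count (g ∘ suc))
    ≡⟨ x∙yz≈y∙xz (ind (f zero)) (ind (f (suc e))) (count (g ∘ suc)) ⟩
  ind (f (suc e)) +ℕ (ind (f zero) +ℕ count (g ∘ suc))
    ≡⟨ cong (λ b → ind (f (suc e)) +ℕ (ind b +ℕ count (g ∘ suc))) (f≗g zero (λ ())) ⟩
  ind (f (suc e)) +ℕ count g ∎
  where open ≡-Reasoning

∣∣≡count : ∀ {n} (S : Subset n) → ∣ S ∣ ≡ count (lookup S)
∣∣≡count []          = refl
∣∣≡count (true ∷ S)  = cong suc (∣∣≡count S)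
∣∣≡count (false ∷ S) = ∣∣≡count S

∣∪⁅⁆∣ : ∀ {n} (S : Subset n) {e} → e ∉ S → ∣ S ∪ ⁅ e ⁆ ∣ ≡ suc ∣ S ∣
∣∪⁅⁆∣ S {e} Se = begin
  ∣ S ∪ ⁅ e ⁆ ∣                            ≡⟨ ∣∣≡count (S ∪ ⁅ e ⁆) ⟩
  count (lookup (S ∪ ⁅ e ⁆))               ≡⟨ count-insert e (∉⇒lookup≡false Se) (λ d → lookup-∪⁅⁆-other S) ⟩
  ind (lookup (S ∪ ⁅ e ⁆) e) +ℕ count (lookup S)
    ≡⟨ cong₂ (λ b c → ind b +ℕ c) (lookup-∪⁅⁆-self S e) (sym (∣∣≡count S)) ⟩
  suc ∣ S ∣                                ∎
  where open ≡-Reasoning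

countNew : ∀ {n} → (Fin n → Bool) → Subset n → Subset n → ℕ
countNew s A R = count (λ d → lookup R d ∧ not (lookup A d) ∧ s d)

countNew-cong : ∀ {n} {s s′ : Fin n → Bool} A R → (∀ d → s d ≡ s′ d) → countNew s A R ≡ countNew s′ A R
countNew-cong A R s≗s′ = count-cong (λ d → cong (λ b → lookup R d ∧ not (lookup A d) ∧ b) (s≗s′ d))

countNew-∅ : ∀ {n} (s : Fin n → Bool) A → countNew s A ∅ ≡ 0
countNew-∅ {n} s A = trans (count-cong (λ d → cong (λ b → b ∧ not (lookup A d) ∧ s d) (lookup-∅ d))) (count-false {n})

countNew-from-∅ : ∀ {n} (s : Fin n → Bool) R → countNew s ∅ R ≡ count (λ d → lookup R d ∧ s d)
countNew-from-∅ s R = count-cong (λ d → cong (λ b → lookup R d ∧ not b ∧ s d) (lookup-∅ d))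

countNew-insert-fresh : ∀ {n} (s : Fin n → Bool) A e R → e ∉ A →
  countNew s A (⁅ e ⁆ ∪ R) ≡ ind (s e) +ℕ countNew s (A ∪ ⁅ e ⁆) R
countNew-insert-fresh s A e R Ae =
  trans (count-insert e {f = λ d → lookup (⁅ e ⁆ ∪ R) d ∧ not (lookup A d) ∧ s d} not-new agree)
        (cong (λ b → ind b +ℕ countNew s (A ∪ ⁅ e ⁆) R) new)
  where
  new : (lookup (⁅ e ⁆ ∪ R) e ∧ not (lookup A e) ∧ s e) ≡ s e
  new rewrite lookup-⁅⁆∪-self e R | ∉⇒lookup≡false Ae = refl
  not-new : (lookup R e ∧ not (lookup (A ∪ ⁅ e ⁆) e) ∧ s e) ≡ false
  not-new rewrite lookup-∪⁅⁆-self A e = ∧-zeroʳ (lookup R e)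
  agree : ∀ d → d ≢ e → (lookup (⁅ e ⁆ ∪ R) d ∧ not (lookup A d) ∧ s d)
                      ≡ (lookup R d ∧ not (lookup (A ∪ ⁅ e ⁆) d) ∧ s d)
  agree d d≢e rewrite lookup-⁅⁆∪-other R d≢e | lookup-∪⁅⁆-other A d≢e = refl

countNew-insert-old : ∀ {n} (s : Fin n → Bool) A e R → e ∈ A →
  countNew s A (⁅ e ⁆ ∪ R) ≡ countNew s A R
countNew-insert-old s A e R Ae = count-cong agree
  where
  agree : ∀ d → (lookup (⁅ e ⁆ ∪ R) d ∧ not (lookup A d) ∧ s d) ≡ (lookup R d ∧ not (lookup A d) ∧ s d)
  agree d with d ≟ e
  ... | yes refl rewrite []=⇒lookup Ae = trans (∧-zeroʳ _) (sym (∧-zeroʳ _))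
  ... | no d≢e rewrite lookup-⁅⁆∪-other R d≢e = refl

countNew-mono : ∀ {n} {s s′ : Fin n → Bool} A R → (∀ d → s d ≡ true → s′ d ≡ true) →
                countNew s A R ≤ℕ countNew s′ A R
countNew-mono A R s⇒s′ = count-mono (λ d → ∧-mono (lookup R d) (not (lookup A d)) (s⇒s′ d))
  where
  ∧-mono : ∀ r a {x y} → (x ≡ true → y ≡ true) → r ∧ a ∧ x ≡ true → r ∧ a ∧ y ≡ true
  ∧-mono true  true  x⇒y = x⇒y
  ∧-mono true  false x⇒y ()
  ∧-mono false a     x⇒y ()

-- Finite sums and expectations

0≤1 : 0ℚ ≤ 1ℚ
0≤1 = ℚP.≤ᵇ⇒≤ _

≤⇒0≤- : ∀ {a b : ℚ} → a ≤ b → 0ℚ ≤ b - a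
≤⇒0≤- {a} {b} a≤b = ℚP.≤-trans (ℚP.≤-reflexive (sym (ℚP.+-inverseʳ a))) (ℚP.+-monoˡ-≤ (- a) a≤b)

0≤-⇒≤ : ∀ {a b : ℚ} → 0ℚ ≤ b - a → a ≤ b
0≤-⇒≤ {a} {b} 0≤b-a = begin
  a               ≡⟨ sym (ℚP.+-identityˡ a) ⟩
  0ℚ + a          ≤⟨ ℚP.+-monoˡ-≤ a 0≤b-a ⟩
  (b - a) + a     ≡⟨ solve 2 (λ a b → (b :- a) :+ a := b) refl a b ⟩
  b               ∎
  where open ℚP.≤-Reasoning

*-nonNeg : ∀ {u v : ℚ} → 0ℚ ≤ u → 0ℚ ≤ v → 0ℚ ≤ u * v
*-nonNeg {u} {v} 0≤u 0≤v =
  ℚP.nonNegative⁻¹ (u * v) {{ℚP.nonNeg*nonNeg⇒nonNeg u {{nonNegative 0≤u}} v {{nonNegative 0≤v}}}}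

*-monoˡ-≤-0≤ : ∀ {r a b : ℚ} → 0ℚ ≤ r → a ≤ b → r * a ≤ r * b
*-monoˡ-≤-0≤ {r} 0≤r = ℚP.*-monoˡ-≤-nonNeg r {{nonNegative 0≤r}}

if-mono : ∀ b {P Q X Y : ℚ} → P ≤ X → Q ≤ Y → (if b then P else Q) ≤ (if b then X else Y)
if-mono true  P≤X Q≤Y = P≤X
if-mono false P≤X Q≤Y = Q≤Y

sumFin-cong : ∀ k {f g : Fin k → ℚ} → (∀ v → f v ≡ g v) → sumFin k f ≡ sumFin k g
sumFin-cong zero    f≗g = refl
sumFin-cong (suc k) f≗g = cong₂ _+_ (f≗g zero) (sumFin-cong k (f≗g ∘ suc))

sumFin-mono : ∀ k {f g : Fin k → ℚ} → (∀ v → f v ≤ g v) → sumFin k f ≤ sumFin k g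
sumFin-mono zero    f≤g = ℚP.≤-refl
sumFin-mono (suc k) f≤g = ℚP.+-mono-≤ (f≤g zero) (sumFin-mono k (f≤g ∘ suc))

sumFin-zero : ∀ k → sumFin k (λ _ → 0ℚ) ≡ 0ℚ
sumFin-zero zero    = refl
sumFin-zero (suc k) = cong (0ℚ +_) (sumFin-zero k)

sumFin-+ : ∀ k (f g : Fin k → ℚ) → sumFin k (λ v → f v + g v) ≡ sumFin k f + sumFin k g
sumFin-+ zero    f g = refl
sumFin-+ (suc k) f g = begin
  (f zero + g zero) + sumFin k (λ v → f (suc v) + g (suc v))
    ≡⟨ cong ((f zero + g zero) +_) (sumFin-+ k (f ∘ suc) (g ∘ suc)) ⟩
  (f zero + g zero) + (sumFin k (f ∘ suc) + sumFin k (g ∘ suc))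
    ≡⟨ +-interchange (f zero) (g zero) _ _ ⟩
  (f zero + sumFin k (f ∘ suc)) + (g zero + sumFin k (g ∘ suc)) ∎
  where open ≡-Reasoning

sumFin-*ˡ : ∀ k (c : ℚ) (f : Fin k → ℚ) → sumFin k (λ v → c * f v) ≡ c * sumFin k f
sumFin-*ˡ zero    c f = sym (ℚP.*-zeroʳ c)
sumFin-*ˡ (suc k) c f =
  trans (cong (c * f zero +_) (sumFin-*ˡ k c (f ∘ suc))) (sym (ℚP.*-distribˡ-+ c (f zero) _))

sumFin-*ʳ : ∀ k (c : ℚ) (f : Fin k → ℚ) → sumFin k (λ v → f v * c) ≡ sumFin k f * c
sumFin-*ʳ k c f =
  trans (sumFin-cong k (λ v → ℚP.*-comm (f v) c)) (trans (sumFin-*ˡ k c f) (ℚP.*-comm c _))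

sumFin-swap : ∀ a b (f : Fin a → Fin b → ℚ) →
  sumFin a (λ i → sumFin b (f i)) ≡ sumFin b (λ j → sumFin a (λ i → f i j))
sumFin-swap zero    b f = sym (sumFin-zero b)
sumFin-swap (suc a) b f =
  trans (cong (sumFin b (f zero) +_) (sumFin-swap a b (f ∘ suc)))
        (sym (sumFin-+ b (f zero) (λ j → sumFin a (λ i → f (suc i) j))))

sumFin-if : ∀ k (a : Fin k → ℚ) (s : Fin k → Bool) (X Y : ℚ) →
  sumFin k (λ v → a v * (if s v then X else Y)) ≡
  sumFin k (λ v → if s v then a v else 0ℚ) * X + (sumFin k a - sumFin k (λ v → if s v then a v else 0ℚ)) * Y
sumFin-if zero    a s X Y = solve 2 (λ X Y → con 0ℚ := con 0ℚ :* X :+ (con 0ℚ :- con 0ℚ) :* Y) refl X Y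

sumFin-if (suc k) a s X Y with s zero
... | true rewrite sumFin-if k (a ∘ suc) (s ∘ suc) X Y =
  solve 5 (λ a S A X Y → a :* X :+ (S :* X :+ (A :- S) :* Y) := (a :+ S) :* X :+ ((a :+ A) :- (a :+ S)) :* Y)
          refl (a zero) (sumFin k (λ v → if s (suc v) then a (suc v) else 0ℚ)) (sumFin k (a ∘ suc)) X Y

... | false rewrite sumFin-if k (a ∘ suc) (s ∘ suc) X Y =
  solve 5 (λ a S A X Y → a :* Y :+ (S :* X :+ (A :- S) :* Y) := (con 0ℚ :+ S) :* X :+ ((a :+ A) :- (con 0ℚ :+ S)) :* Y)
          refl (a zero) (sumFin k (λ v → if s (suc v) then a (suc v) else 0ℚ)) (sumFin k (a ∘ suc)) X Y

_[_↦_] : ∀ {n} {A : Set} → (Fin n → A) → Fin n → A → Fin n → A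
x [ e ↦ v ] = updateAt x e (const v)

↦-cong : ∀ {n} {A : Set} {x y : Fin n → A} e v → x ≗ y → x [ e ↦ v ] ≗ y [ e ↦ v ]
↦-cong {x = x} {y} e v x≗y d with d ≟ e
... | yes refl = trans (updateAt-updates e x) (sym (updateAt-updates e y))
... | no d≢e   = trans (updateAt-minimal d e x d≢e) (trans (x≗y d) (sym (updateAt-minimal d e y d≢e)))

∷-cong : ∀ {n} {A : Set} (v : A) {x y : Fin n → A} → x ≗ y → (v ∷ᶠ x) ≗ (v ∷ᶠ y)
∷-cong v x≗y zero    = refl
∷-cong v x≗y (suc d) = x≗y d

↦-∷-zero : ∀ {n} {A : Set} (w v : A) (x : Fin n → A) → (w ∷ᶠ x) [ zero ↦ v ] ≗ v ∷ᶠ x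
↦-∷-zero w v x zero    = refl
↦-∷-zero w v x (suc d) = refl

↦-∷-suc : ∀ {n} {A : Set} (w : A) e v (x : Fin n → A) → (w ∷ᶠ x) [ suc e ↦ v ] ≗ w ∷ᶠ (x [ e ↦ v ])
↦-∷-suc w e v x zero    = refl
↦-∷-suc w e v x (suc d) = refl

Extensional : ∀ {n m} → (Outcome n m → ℚ) → Set
Extensional f = ∀ {x y} → x ≗ y → f x ≡ f y

-- The two clauses for v = zero and v = suc j keep the outcome built by Expect's pattern
-- lambda visible to unification.
Expect-cong : ∀ {n m} (p : Fin n → Fin (suc m) → ℚ) {f g : Outcome n m → ℚ} →
              (∀ x → f x ≡ g x) → Expect p f ≡ Expect p g
Expect-cong {zero}      p f≗g = f≗g _
Expect-cong {suc n} {m} p f≗g =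
  cong₂ _+_ (cong (p zero zero *_) (Expect-cong (p ∘ suc) (λ x → f≗g _)))
            (sumFin-cong m (λ j → cong (p zero (suc j) *_) (Expect-cong (p ∘ suc) (λ x → f≗g _))))

Pr-cong : ∀ {n m} (p : Fin n → Fin (suc m) → ℚ) {P Q : Outcome n m → Bool} →
          (∀ x → P x ≡ Q x) → Pr p P ≡ Pr p Q
Pr-cong p P≗Q = Expect-cong p (λ x → cong (λ b → if b then 1ℚ else 0ℚ) (P≗Q x))

Pr-if : ∀ {n m} (p : Fin n → Fin (suc m) → ℚ) b (P Q : Outcome n m → Bool) →
        Pr p (λ x → if b then P x else Q x) ≡ (if b then Pr p P else Pr p Q)
Pr-if p true  P Q = refl
Pr-if p false P Q = refl

IsDistributions-tail : ∀ {n m} {p : Fin (suc n) → Fin (suc m) → ℚ} →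
                       IsDistributions p → IsDistributions (p ∘ suc)
IsDistributions-tail (p≥0 , Σp≡1) = p≥0 ∘ suc , Σp≡1 ∘ suc

Expect-const : ∀ {n m} (p : Fin n → Fin (suc m) → ℚ) → IsDistributions p →
               (c : ℚ) → Expect {n} {m} p (λ _ → c) ≡ c
Expect-const {zero}      p dist c = refl
Expect-const {suc n} {m} p dist c = begin
  sumFin (suc m) (λ v → p zero v * Expect (p ∘ suc) (λ _ → c))
    ≡⟨ sumFin-cong (suc m) (λ v → cong (p zero v *_) (Expect-const (p ∘ suc) (IsDistributions-tail dist) c)) ⟩
  sumFin (suc m) (λ v → p zero v * c)   ≡⟨ sumFin-*ʳ (suc m) c (p zero) ⟩
  sumFin (suc m) (p zero) * c           ≡⟨ cong (_* c) (proj₂ dist zero) ⟩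
  1ℚ * c                                ≡⟨ ℚP.*-identityˡ c ⟩
  c                                     ∎
  where open ≡-Reasoning

Expect-unfold : ∀ {n m} (p : Fin (suc n) → Fin (suc m) → ℚ) {f : Outcome (suc n) m → ℚ} → Extensional f →
                Expect p f ≡ sumFin (suc m) (λ v → p zero v * Expect (p ∘ suc) (λ x → f (v ∷ᶠ x)))
Expect-unfold {n} {m} p ext =
  cong₂ _+_ (cong (p zero zero *_) (Expect-cong (p ∘ suc) (λ x → ext λ { zero → refl ; (suc d) → refl })))
            (sumFin-cong m (λ j → cong (p zero (suc j) *_)
                                       (Expect-cong (p ∘ suc) (λ x → ext λ { zero → refl ; (suc d) → refl }))))

Expect-condition : ∀ {n m} (p : Fin n → Fin (suc m) → ℚ) → IsDistributions p →
  {f : Outcome n m → ℚ} → Extensional f → ∀ e →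
  Expect p f ≡ sumFin (suc m) (λ v → p e v * Expect p (λ x → f (x [ e ↦ v ])))
Expect-condition {suc n} {m} p dist {f} ext zero = begin
  Expect p f
    ≡⟨ Expect-unfold p ext ⟩
  sumFin (suc m) (λ v → p zero v * Expect (p ∘ suc) (λ x → f (v ∷ᶠ x)))
    ≡⟨ sumFin-cong (suc m) (λ v → cong (p zero v *_) (sym (revealed v))) ⟩
  sumFin (suc m) (λ v → p zero v * Expect p (λ x → f (x [ zero ↦ v ]))) ∎
  where
  open ≡-Reasoning
  revealed : ∀ v → Expect p (λ x → f (x [ zero ↦ v ])) ≡ Expect (p ∘ suc) (λ x → f (v ∷ᶠ x))
  revealed v = begin
    Expect p (λ x → f (x [ zero ↦ v ]))
      ≡⟨ Expect-unfold p (ext ∘ ↦-cong zero v) ⟩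
    sumFin (suc m) (λ w → p zero w * Expect (p ∘ suc) (λ x → f ((w ∷ᶠ x) [ zero ↦ v ])))
      ≡⟨ sumFin-cong (suc m) (λ w → cong (p zero w *_)
           (Expect-cong (p ∘ suc) (λ x → ext (↦-∷-zero w v x)))) ⟩
    sumFin (suc m) (λ w → p zero w * Expect (p ∘ suc) (λ x → f (v ∷ᶠ x)))
      ≡⟨ sumFin-*ʳ (suc m) (Expect (p ∘ suc) (λ x → f (v ∷ᶠ x))) (p zero) ⟩
    sumFin (suc m) (p zero) * Expect (p ∘ suc) (λ x → f (v ∷ᶠ x))
      ≡⟨ cong (_* Expect (p ∘ suc) (λ x → f (v ∷ᶠ x))) (proj₂ dist zero) ⟩
    1ℚ * Expect (p ∘ suc) (λ x → f (v ∷ᶠ x))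
      ≡⟨ ℚP.*-identityˡ _ ⟩
    Expect (p ∘ suc) (λ x → f (v ∷ᶠ x)) ∎
Expect-condition {suc n} {m} p dist {f} ext (suc e) = begin
  Expect p f
    ≡⟨ Expect-unfold p ext ⟩
  sumFin (suc m) (λ w → p zero w * Expect (p ∘ suc) (λ x → f (w ∷ᶠ x)))
    ≡⟨ sumFin-cong (suc m) (λ w → cong (p zero w *_)
         (Expect-condition (p ∘ suc) (IsDistributions-tail dist) (ext ∘ ∷-cong w) e)) ⟩
  sumFin (suc m) (λ w → p zero w * sumFin (suc m) (λ v → p (suc e) v * C w v))
    ≡⟨ sumFin-cong (suc m) (λ w → sym (sumFin-*ˡ (suc m) (p zero w) (λ v → p (suc e) v * C w v))) ⟩
  sumFin (suc m) (λ w → sumFin (suc m) (λ v → p zero w * (p (suc e) v * C w v)))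
    ≡⟨ sumFin-swap (suc m) (suc m) (λ w v → p zero w * (p (suc e) v * C w v)) ⟩
  sumFin (suc m) (λ v → sumFin (suc m) (λ w → p zero w * (p (suc e) v * C w v)))
    ≡⟨ sumFin-cong (suc m) (λ v → trans (sumFin-cong (suc m) (λ w → *-exchange (p zero w) (p (suc e) v) (C w v)))
                                        (sumFin-*ˡ (suc m) (p (suc e) v) (λ w → p zero w * C w v))) ⟩
  sumFin (suc m) (λ v → p (suc e) v * sumFin (suc m) (λ w → p zero w * C w v))
    ≡⟨ sumFin-cong (suc m) (λ v → cong (p (suc e) v *_) (sym (conditioned v))) ⟩
  sumFin (suc m) (λ v → p (suc e) v * Expect p (λ x → f (x [ suc e ↦ v ]))) ∎
  where
  open ≡-Reasoning
  C : Fin (suc m) → Fin (suc m) → ℚ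
  C w v = Expect (p ∘ suc) (λ x → f (w ∷ᶠ (x [ e ↦ v ])))
  conditioned : ∀ v → Expect p (λ x → f (x [ suc e ↦ v ])) ≡ sumFin (suc m) (λ w → p zero w * C w v)
  conditioned v = trans (Expect-unfold p (ext ∘ ↦-cong (suc e) v))
    (sumFin-cong (suc m) (λ w → cong (p zero w *_) (Expect-cong (p ∘ suc) (λ x → ext (↦-∷-suc w e v x)))))

-- Tails of sums of independent Bernoulli variables

IsProb : ℚ → Set
IsProb b = 0ℚ ≤ b × b ≤ 1ℚ

convex-mono : ∀ {b x x′ y y′ : ℚ} → IsProb b → x ≤ x′ → y ≤ y′ →
              b * x + (1ℚ - b) * y ≤ b * x′ + (1ℚ - b) * y′
convex-mono (0≤b , b≤1) x≤x′ y≤y′ =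
  ℚP.+-mono-≤ (*-monoˡ-≤-0≤ 0≤b x≤x′) (*-monoˡ-≤-0≤ (≤⇒0≤- b≤1) y≤y′)

convex-weight-mono : ∀ {a b x y : ℚ} → a ≤ b → y ≤ x →
                     a * x + (1ℚ - a) * y ≤ b * x + (1ℚ - b) * y
convex-weight-mono {a} {b} {x} {y} a≤b y≤x = 0≤-⇒≤ (begin
  0ℚ                                                ≤⟨ *-nonNeg (≤⇒0≤- a≤b) (≤⇒0≤- y≤x) ⟩
  (b - a) * (x - y)                                 ≡⟨ difference ⟩
  (b * x + (1ℚ - b) * y) - (a * x + (1ℚ - a) * y)   ∎)
  where
  open ℚP.≤-Reasoning
  difference : (b - a) * (x - y) ≡ (b * x + (1ℚ - b) * y) - (a * x + (1ℚ - a) * y)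
  difference = solve 4 (λ a b x y → (b :- a) :* (x :- y)
                                 := (b :* x :+ (con 1ℚ :- b) :* y) :- (a :* x :+ (con 1ℚ :- a) :* y)) refl a b x y

tailProb : List ℚ → ℕ → ℚ
tailProb B       zero    = 1ℚ
tailProb []      (suc j) = 0ℚ
tailProb (b ∷ B) (suc j) = b * tailProb B j + (1ℚ - b) * tailProb B (suc j)

tailProb-isProb : ∀ {B} → All IsProb B → ∀ j → IsProb (tailProb B j)
tailProb-isProb B-probs           zero    = 0≤1 , ℚP.≤-refl
tailProb-isProb []                (suc j) = ℚP.≤-refl , 0≤1
tailProb-isProb {b ∷ B} (b-prob@(0≤b , b≤1) ∷ B-probs) (suc j) =
  ℚP.+-mono-≤ (*-nonNeg 0≤b (proj₁ (tailProb-isProb B-probs j)))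
              (*-nonNeg (≤⇒0≤- b≤1) (proj₁ (tailProb-isProb B-probs (suc j)))) ,
  ℚP.≤-trans (convex-mono b-prob (proj₂ (tailProb-isProb B-probs j)) (proj₂ (tailProb-isProb B-probs (suc j))))
             (ℚP.≤-reflexive (solve 1 (λ b → b :* con 1ℚ :+ (con 1ℚ :- b) :* con 1ℚ := con 1ℚ) refl b))

tailProb-antitone : ∀ {B} → All IsProb B → ∀ j → tailProb B (suc j) ≤ tailProb B j
tailProb-antitone B-probs         zero    = proj₂ (tailProb-isProb B-probs 1)
tailProb-antitone []              (suc j) = ℚP.≤-refl
tailProb-antitone (b-prob ∷ B-probs) (suc j) =
  convex-mono b-prob (tailProb-antitone B-probs j) (tailProb-antitone B-probs (suc j))

tailProb-swap : ∀ a b B j → tailProb (a ∷ b ∷ B) j ≡ tailProb (b ∷ a ∷ B) j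
tailProb-swap a b B zero          = refl
tailProb-swap a b B (suc zero)    =
  solve 3 (λ a b X → a :* con 1ℚ :+ (con 1ℚ :- a) :* (b :* con 1ℚ :+ (con 1ℚ :- b) :* X)
                  := b :* con 1ℚ :+ (con 1ℚ :- b) :* (a :* con 1ℚ :+ (con 1ℚ :- a) :* X)) refl a b (tailProb B 1)
tailProb-swap a b B (suc (suc j)) =
  solve 5 (λ a b X Y Z → a :* (b :* X :+ (con 1ℚ :- b) :* Y) :+ (con 1ℚ :- a) :* (b :* Y :+ (con 1ℚ :- b) :* Z)
                      := b :* (a :* X :+ (con 1ℚ :- a) :* Y) :+ (con 1ℚ :- b) :* (a :* Y :+ (con 1ℚ :- a) :* Z))
          refl a b (tailProb B j) (tailProb B (suc j)) (tailProb B (suc (suc j)))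

tailProb-cons-cong : ∀ a {B B′} → (∀ j → tailProb B j ≡ tailProb B′ j) →
                     ∀ j → tailProb (a ∷ B) j ≡ tailProb (a ∷ B′) j
tailProb-cons-cong a B≗B′ zero    = refl
tailProb-cons-cong a B≗B′ (suc j) = cong₂ (λ u w → a * u + (1ℚ - a) * w) (B≗B′ j) (B≗B′ (suc j))

tailProb-extract : ∀ L₁ b L₂ j → tailProb (L₁ ++ b ∷ L₂) j ≡ tailProb (b ∷ L₁ ++ L₂) j
tailProb-extract []       b L₂ j = refl
tailProb-extract (a ∷ L₁) b L₂ j =
  trans (tailProb-cons-cong a (tailProb-extract L₁ b L₂) j) (tailProb-swap a b (L₁ ++ L₂) j)

does⇒ : ∀ {P : Set} (P? : Dec P) → does P? ≡ true → P
does⇒ (yes p) _ = p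

countAbove : ℚ → List ℚ → ℕ
countAbove c []      = 0
countAbove c (b ∷ B) = ind (does (c ≤? b)) +ℕ countAbove c B

countAbove-extract : ∀ c L₁ b L₂ → countAbove c (L₁ ++ b ∷ L₂) ≡ ind (does (c ≤? b)) +ℕ countAbove c (L₁ ++ L₂)
countAbove-extract c []       b L₂ = refl
countAbove-extract c (x ∷ L₁) b L₂ =
  trans (cong (ind (does (c ≤? x)) +ℕ_) (countAbove-extract c L₁ b L₂))
        (x∙yz≈y∙xz (ind (does (c ≤? x))) (ind (does (c ≤? b))) (countAbove c (L₁ ++ L₂)))

Outside : ℚ → ℚ → List ℚ → Set
Outside a b = All (λ y → a ≤ y → b ≤ y)

countAbove-Outside : ∀ {a b c} L → Outside a b L → a ≤ c → c ≤ b → countAbove c L ≡ countAbove a L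
countAbove-Outside []      []         a≤c c≤b = refl
countAbove-Outside {a} {b} {c} (y ∷ L) (gap ∷ gaps) a≤c c≤b =
  cong₂ _+ℕ_ (cong ind same) (countAbove-Outside L gaps a≤c c≤b)
  where
  same : does (c ≤? y) ≡ does (a ≤? y)
  same = does-⇔ (mk⇔ (ℚP.≤-trans a≤c) (ℚP.≤-trans c≤b ∘ gap)) (c ≤? y) (a ≤? y)

countAbove≡0⇒Outside : ∀ {a} b L → countAbove a L ≡ 0 → Outside a b L
countAbove≡0⇒Outside         b []      none = []
countAbove≡0⇒Outside {a} b (y ∷ L) none =
  (λ a≤y → contradiction (trans (cong (λ t → ind t +ℕ countAbove a L) (sym (dec-true (a ≤? y) a≤y))) none) λ ())
  ∷ countAbove≡0⇒Outside b L (ℕP.m+n≡0⇒n≡0 (ind (does (a ≤? y))) none)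

record LeastAbove (a : ℚ) (B : List ℚ) : Set where
  constructor leastAbove
  field
    before  : List ℚ
    least   : ℚ
    after   : List ℚ
    split   : B ≡ before ++ least ∷ after
    a≤least : a ≤ least
    outside : Outside a least (before ++ after)

splitLeastAbove : ∀ a B → countAbove a B ≡ 0 ⊎ LeastAbove a B
splitLeastAbove a [] = inj₁ refl
splitLeastAbove a (x ∷ B) with a ≤? x | splitLeastAbove a B
... | no a≰x  | inj₁ none = inj₁ (trans (cong (λ t → ind t +ℕ countAbove a B) (dec-false (a ≤? x) a≰x)) none)
... | no a≰x  | inj₂ (leastAbove L₁ b L₂ refl a≤b gaps) =
  inj₂ (leastAbove (x ∷ L₁) b L₂ refl a≤b ((λ a≤x → contradiction a≤x a≰x) ∷ gaps))
... | yes a≤x | inj₁ none = inj₂ (leastAbove [] x B refl a≤x (countAbove≡0⇒Outside x B none))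
... | yes a≤x | inj₂ (leastAbove L₁ b L₂ refl a≤b gaps) with ℚP.≤-total x b
...   | inj₁ x≤b = inj₂ (leastAbove [] x (L₁ ++ b ∷ L₂) refl a≤x
                     (All.map (λ b≤ a≤y → ℚP.≤-trans x≤b (b≤ a≤y))
                              (++⁺ (++⁻ˡ L₁ gaps) ((λ _ → ℚP.≤-refl) ∷ ++⁻ʳ L₁ gaps))))
...   | inj₂ b≤x = inj₂ (leastAbove (x ∷ L₁) b L₂ refl a≤b ((λ _ → b≤x) ∷ gaps))

-- Matroids and the greedy algorithm

greedyPicks : ∀ {n} {I : Subset n → Set} {w : Fin n → ℚ} {S G} → Greedy I w S G → List (Fin n)
greedyPicks (done _)            = []
greedyPicks (step e _ _ _ rest) = e ∷ greedyPicks rest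

module Dominance {n : ℕ} (I : Subset n → Set) (matroid : IsMatroid I) (q : Fin n → ℚ) where
  open IsMatroid matroid

  above : ℚ → Fin n → Bool
  above c d = does (c ≤? q d)

  Dominates : Subset n → List ℚ → Set
  Dominates A B = ∀ c T → I (A ∪ T) → countNew (above c) A T ≤ℕ countAbove c B

  dominates-insert : ∀ {A B e} → Dominates A B → e ∉ A → ∀ c T → I ((A ∪ ⁅ e ⁆) ∪ T) →
                     ind (above c e) +ℕ countNew (above c) (A ∪ ⁅ e ⁆) T ≤ℕ countAbove c B
  dominates-insert {A} {B} {e} dom Ae c T indep =
    subst (_≤ℕ countAbove c B) (countNew-insert-fresh (above c) A e T Ae)
          (dom c (⁅ e ⁆ ∪ T) (subst I (∪-assoc A ⁅ e ⁆ T) indep))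

  -- No weight of L₁ ++ L₂ lies in [q e, b), so thresholds between q e and b count like q e.
  dominates-remove : ∀ {A e} L₁ b L₂ → Dominates A (L₁ ++ b ∷ L₂) → e ∉ A → q e ≤ b →
                     Outside (q e) b (L₁ ++ L₂) → Dominates (A ∪ ⁅ e ⁆) (L₁ ++ L₂)
  dominates-remove {A} {e} L₁ b L₂ dom Ae qe≤b gaps = dominated
    where
    N : ℚ → Subset n → ℕ
    N c T = countNew (above c) (A ∪ ⁅ e ⁆) T
    M : ℚ → ℕ
    M c = countAbove c (L₁ ++ L₂)
    both : ∀ c T → I ((A ∪ ⁅ e ⁆) ∪ T) → ind (above c e) +ℕ N c T ≤ℕ ind (does (c ≤? b)) +ℕ M c
    both c T indep = ℕP.≤-trans (dominates-insert {A} {L₁ ++ b ∷ L₂} dom Ae c T indep)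
                                (ℕP.≤-reflexive (countAbove-extract c L₁ b L₂))
    low : ∀ c T → I ((A ∪ ⁅ e ⁆) ∪ T) → c ≤ q e → N c T ≤ℕ M c
    low c T indep c≤qe = ℕP.+-cancelˡ-≤ 1 (N c T) (M c)
      (subst₂ (λ u v → ind u +ℕ N c T ≤ℕ ind v +ℕ M c)
              (dec-true (c ≤? q e) c≤qe) (dec-true (c ≤? b) (ℚP.≤-trans c≤qe qe≤b)) (both c T indep))
    dominated : Dominates (A ∪ ⁅ e ⁆) (L₁ ++ L₂)
    dominated c T indep with c ≤? q e | c ≤? b
    ... | yes c≤qe | _       = low c T indep c≤qe
    ... | no c≰qe  | no c≰b  = subst₂ (λ u v → ind u +ℕ N c T ≤ℕ ind v +ℕ M c)
                                      (dec-false (c ≤? q e) c≰qe) (dec-false (c ≤? b) c≰b) (both c T indep)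
    ... | no c≰qe  | yes c≤b = begin
      N c T     ≤⟨ countNew-mono (A ∪ ⁅ e ⁆) T raise ⟩
      N (q e) T ≤⟨ low (q e) T indep ℚP.≤-refl ⟩
      M (q e)   ≡⟨ countAbove-Outside (L₁ ++ L₂) gaps qe≤c c≤b ⟨
      M c       ∎
      where
      open ℕP.≤-Reasoning
      qe≤c : q e ≤ c
      qe≤c = ℚP.<⇒≤ (ℚP.≰⇒> c≰qe)
      raise : ∀ d → above c d ≡ true → above (q e) d ≡ true
      raise d c≤qd = dec-true (q e ≤? q d) (ℚP.≤-trans qe≤c (does⇒ (c ≤? q d) c≤qd))

  dominates-extend : ∀ {A B e} → Dominates A B → e ∉ A → I (A ∪ ⁅ e ⁆) →
                     Σ[ s ∈ LeastAbove (q e) B ] Dominates (A ∪ ⁅ e ⁆) (LeastAbove.before s ++ LeastAbove.after s)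
  dominates-extend {A} {B} {e} dom Ae indep with splitLeastAbove (q e) B
  ... | inj₁ none = contradiction (subst (1 ≤ℕ_) none e-counted) λ ()
    where
    e-counted : 1 ≤ℕ countAbove (q e) B
    e-counted = subst₂ (λ t k → ind t +ℕ k ≤ℕ countAbove (q e) B)
                       (dec-true (q e ≤? q e) ℚP.≤-refl) (countNew-∅ (above (q e)) (A ∪ ⁅ e ⁆))
                       (dominates-insert {A} {B} dom Ae (q e) ∅ (subst I (sym (∪-identityʳ _)) indep))
  ... | inj₂ s@(leastAbove L₁ b L₂ refl qe≤b gaps) = s , dominates-remove L₁ b L₂ dom Ae qe≤b gaps

  greedyWeights : ∀ {S G} → Greedy I q S G → List ℚ
  greedyWeights D = map q (greedyPicks D)

  exchange-bound : ∀ {S T} → I S → I T → (∀ f → f ∈ T → f ∉ S → ¬ I (S ∪ ⁅ f ⁆)) → ∣ T ∣ ≤ℕ ∣ S ∣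
  exchange-bound {S} {T} iS iT no-exchange = ℕP.≮⇒≥ λ ∣S∣<∣T∣ →
    let f , f∈T , f∉S , iSf = exchange S T iS iT ∣S∣<∣T∣ in no-exchange f f∈T f∉S iSf

  aboveIn : ℚ → Subset n → Subset n
  aboveIn c T = tabulate (λ d → lookup T d ∧ above c d)

  lookup-aboveIn : ∀ c T d → lookup (aboveIn c T) d ≡ (lookup T d ∧ above c d)
  lookup-aboveIn c T d = lookup∘tabulate (λ d → lookup T d ∧ above c d) d

  ∈aboveIn⇒ : ∀ {c T d} → d ∈ aboveIn c T → d ∈ T × c ≤ q d
  ∈aboveIn⇒ {c} {T} {d} d∈ with lookup T d in Td | trans (sym (lookup-aboveIn c T d)) ([]=⇒lookup d∈)
  ... | true | c≤qd = lookup⇒[]= d T Td , does⇒ (c ≤? q d) c≤qd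

  aboveIn-independent : ∀ c {T} → I T → I (aboveIn c T)
  aboveIn-independent c {T} iT = hereditary (aboveIn c T) T (λ d∈ → proj₁ (∈aboveIn⇒ {c} {T} d∈)) iT

  -- The classical optimality of the matroid greedy algorithm, threshold by threshold.
  greedy-bound : ∀ c {T} → I T → ∀ {S G} (D : Greedy I q S G) → I S →
                 ∣ aboveIn c T ∣ ≤ℕ ∣ S ∣ +ℕ countAbove c (greedyWeights D)
  greedy-bound c iT (done maximal) iS =
    ℕP.≤-trans (exchange-bound iS (aboveIn-independent c iT) (λ f _ → maximal f)) (ℕP.m≤m+n _ 0)
  greedy-bound c {T} iT {S} (step e e∉S iSe heaviest D) iS with c ≤? q e
  ... | yes c≤qe = begin
    ∣ aboveIn c T ∣             ≤⟨ greedy-bound c iT D iSe ⟩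
    ∣ S ∪ ⁅ e ⁆ ∣ +ℕ rest       ≡⟨ cong (_+ℕ rest) (∣∪⁅⁆∣ S e∉S) ⟩
    suc ∣ S ∣ +ℕ rest           ≡⟨ ℕP.+-suc ∣ S ∣ rest ⟨
    ∣ S ∣ +ℕ (1 +ℕ rest)        ≡⟨ cong (λ b → ∣ S ∣ +ℕ (ind b +ℕ rest)) (dec-true (c ≤? q e) c≤qe) ⟨
    ∣ S ∣ +ℕ countAbove c (q e ∷ greedyWeights D) ∎
    where
    open ℕP.≤-Reasoning
    rest = countAbove c (greedyWeights D)
  ... | no c≰qe = ℕP.≤-trans (exchange-bound iS (aboveIn-independent c iT) too-light) (ℕP.m≤m+n _ _)
    where
    too-light : ∀ f → f ∈ aboveIn c T → f ∉ S → ¬ I (S ∪ ⁅ f ⁆)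
    too-light f f∈ f∉S iSf = c≰qe (ℚP.≤-trans (proj₂ (∈aboveIn⇒ {c} {T} f∈)) (heaviest f f∉S iSf))

  greedy-dominates : ∀ {G} (D : Greedy I q ∅ G) → Dominates ∅ (greedyWeights D)
  greedy-dominates D c T indep = begin
    countNew (above c) ∅ T                    ≡⟨ countNew-from-∅ (above c) T ⟩
    count (λ d → lookup T d ∧ above c d)      ≡⟨ count-cong (lookup-aboveIn c T) ⟨
    count (lookup (aboveIn c T))              ≡⟨ ∣∣≡count (aboveIn c T) ⟨
    ∣ aboveIn c T ∣                           ≤⟨ greedy-bound c (subst I (∪-identityˡ T) indep) D empty-indep ⟩
    ∣ ∅ {n} ∣ +ℕ countAbove c (greedyWeights D) ≡⟨ cong (_+ℕ countAbove c (greedyWeights D)) (∣⊥∣≡0 n) ⟩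
    countAbove c (greedyWeights D)            ∎
    where open ℕP.≤-Reasoning

-- Adaptive policies

run-cong : ∀ {n m} (π : Policy n m) {x y : Outcome n m} → x ≗ y → run π x ≡ run π y
run-cong stop       x≗y = refl
run-cong (pick e k) {x} {y} x≗y rewrite x≗y e = cong (⁅ e ⁆ ∪_) (run-cong (k (y e)) x≗y)

pickAll : ∀ {n m} → List (Fin n) → Policy n m
pickAll []       = stop
pickAll (e ∷ es) = pick e (λ _ → pickAll es)

greedy-output : ∀ {n m} {I : Subset n → Set} {w : Fin n → ℚ} {S G} (D : Greedy I w S G) (z : Outcome n m) →
                G ≡ S ∪ run (pickAll (greedyPicks D)) z
greedy-output {S = S} (done _)           z = sym (∪-identityʳ S)
greedy-output {S = S} (step e _ _ _ D) z = trans (greedy-output D z) (∪-assoc S ⁅ e ⁆ _)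

suc≤ᵇind+ : ∀ b j N → (suc j ≤ᵇ ind b +ℕ N) ≡ (if b then j ≤ᵇ N else suc j ≤ᵇ N)
suc≤ᵇind+ true  zero    N = refl
suc≤ᵇind+ true  (suc j) N = refl
suc≤ᵇind+ false j       N = refl

module Policies {n m : ℕ} (I : Subset n → Set) (matroid : IsMatroid I)
                (p : Fin n → Fin (suc m) → ℚ) (dist : IsDistributions p) (t : ℕ) where

  open IsMatroid matroid
  open Dominance I matroid (probLe p t)

  q : Fin n → ℚ
  q = probLe p t

  q-isProb : ∀ e → IsProb (q e)
  q-isProb e = ℚP.≤-trans (ℚP.≤-reflexive (sym (sumFin-zero (suc m)))) (sumFin-mono (suc m) nonNeg) ,
               ℚP.≤-trans (sumFin-mono (suc m) ≤p) (ℚP.≤-reflexive (proj₂ dist e))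
    where
    nonNeg : ∀ v → 0ℚ ≤ (if toℕ v ≤ᵇ t then p e v else 0ℚ)
    nonNeg v with toℕ v ≤ᵇ t
    ... | true  = proj₁ dist e v
    ... | false = ℚP.≤-refl
    ≤p : ∀ v → (if toℕ v ≤ᵇ t then p e v else 0ℚ) ≤ p e v
    ≤p v with toℕ v ≤ᵇ t
    ... | true  = ℚP.≤-refl
    ... | false = proj₁ dist e v

  success-average : ∀ e (X Y : ℚ) →
    sumFin (suc m) (λ v → p e v * (if toℕ v ≤ᵇ t then X else Y)) ≡ q e * X + (1ℚ - q e) * Y
  success-average e X Y =
    trans (sumFin-if (suc m) (p e) (λ v → toℕ v ≤ᵇ t) X Y) (cong (λ S → q e * X + (S - q e) * Y) (proj₂ dist e))

  below : Outcome n m → Fin n → Bool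
  below z d = toℕ (z d) ≤ᵇ t

  gain : Policy n m → Subset n → Outcome n m → ℕ
  gain π A z = countNew (below z) A (run π z)

  gain-cong : ∀ π A {z z′} → z ≗ z′ → gain π A z ≡ gain π A z′
  gain-cong π A {z} {z′} z≗z′ =
    trans (cong (countNew (below z) A) (run-cong π z≗z′))
          (countNew-cong A (run π z′) (λ d → cong (λ v → toℕ v ≤ᵇ t) (z≗z′ d)))

  gain-pick-fresh : ∀ e k A z → e ∉ A →
                    gain (pick e k) A z ≡ ind (below z e) +ℕ gain (k (z e)) (A ∪ ⁅ e ⁆) z
  gain-pick-fresh e k A z Ae = countNew-insert-fresh (below z) A e (run (k (z e)) z) Ae

  gain-pick-known : ∀ e k A z → e ∈ A → gain (pick e k) A z ≡ gain (k (z e)) A z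
  gain-pick-known e k A z Ae = countNew-insert-old (below z) A e (run (k (z e)) z) Ae

  -- The world x in which the elements of A have revealed the values y.
  override : Subset n → Outcome n m → Outcome n m → Outcome n m
  override A y x d = if lookup A d then y d else x d

  override-known : ∀ A {e} y x → e ∈ A → override A y x e ≡ y e
  override-known A y x Ae rewrite []=⇒lookup Ae = refl

  override-cong : ∀ A y {x x′} → x ≗ x′ → override A y x ≗ override A y x′
  override-cong A y x≗x′ d = cong (if lookup A d then y d else_) (x≗x′ d)

  override-fresh : ∀ A {e} y x → e ∉ A → override A y x e ≡ x e
  override-fresh A y x Ae rewrite ∉⇒lookup≡false Ae = refl

  override-reveal : ∀ A e y x v → e ∉ A →
                    override A y (x [ e ↦ v ]) ≗ override (A ∪ ⁅ e ⁆) (y [ e ↦ v ]) x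
  override-reveal A e y x v Ae d with d ≟ e
  ... | yes refl rewrite ∉⇒lookup≡false Ae | lookup-∪⁅⁆-self A e =
    trans (updateAt-updates e x) (sym (updateAt-updates e y))
  ... | no d≢e rewrite lookup-∪⁅⁆-other A d≢e =
    cong₂ (λ u w → if lookup A d then u else w) (sym (updateAt-minimal d e y d≢e)) (updateAt-minimal d e x d≢e)

  -- After A has been selected and its values revealed as y: does π, in the world x, collect j
  -- successes outside A?
  wins : Policy n m → Subset n → Outcome n m → ℕ → Outcome n m → Bool
  wins π A y j x = j ≤ᵇ gain π A (override A y x)

  winProb : Policy n m → Subset n → Outcome n m → ℕ → ℚ
  winProb π A y j = Pr p (wins π A y j)

  wins-extensional : ∀ π A y j → Extensional (λ x → if wins π A y j x then 1ℚ else 0ℚ)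
  wins-extensional π A y j x≗x′ =
    cong (λ N → if j ≤ᵇ N then 1ℚ else 0ℚ) (gain-cong π A (override-cong A y x≗x′))

  revealed-value : ∀ A e y x v → e ∉ A → override A y (x [ e ↦ v ]) e ≡ v
  revealed-value A e y x v Ae = trans (override-fresh A y (x [ e ↦ v ]) Ae) (updateAt-updates e x)

  run-reveal : ∀ e k A y x v → e ∉ A →
    A ∪ run (pick e k) (override A y (x [ e ↦ v ])) ≡ (A ∪ ⁅ e ⁆) ∪ run (k v) (override (A ∪ ⁅ e ⁆) (y [ e ↦ v ]) x)
  run-reveal e k A y x v Ae = begin
    A ∪ ⁅ e ⁆ ∪ run (k (z e)) z        ≡⟨ cong (λ w → A ∪ ⁅ e ⁆ ∪ run (k w) z) (revealed-value A e y x v Ae) ⟩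
    A ∪ ⁅ e ⁆ ∪ run (k v) z            ≡⟨ cong (λ R → A ∪ ⁅ e ⁆ ∪ R) (run-cong (k v) z≗z′) ⟩
    A ∪ ⁅ e ⁆ ∪ run (k v) z′           ≡⟨ ∪-assoc A ⁅ e ⁆ _ ⟨
    (A ∪ ⁅ e ⁆) ∪ run (k v) z′         ∎
    where
    open ≡-Reasoning
    z = override A y (x [ e ↦ v ])
    z′ = override (A ∪ ⁅ e ⁆) (y [ e ↦ v ]) x
    z≗z′ : z ≗ z′
    z≗z′ = override-reveal A e y x v Ae

  gain-reveal : ∀ e k A y x v → e ∉ A →
    gain (pick e k) A (override A y (x [ e ↦ v ])) ≡
    ind (toℕ v ≤ᵇ t) +ℕ gain (k v) (A ∪ ⁅ e ⁆) (override (A ∪ ⁅ e ⁆) (y [ e ↦ v ]) x)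
  gain-reveal e k A y x v Ae = begin
    gain (pick e k) A z                            ≡⟨ gain-pick-fresh e k A z Ae ⟩
    ind (below z e) +ℕ gain (k (z e)) (A ∪ ⁅ e ⁆) z
      ≡⟨ cong (λ w → ind (toℕ w ≤ᵇ t) +ℕ gain (k w) (A ∪ ⁅ e ⁆) z) ze ⟩
    ind (toℕ v ≤ᵇ t) +ℕ gain (k v) (A ∪ ⁅ e ⁆) z
      ≡⟨ cong (ind (toℕ v ≤ᵇ t) +ℕ_) (gain-cong (k v) (A ∪ ⁅ e ⁆) z≗z′) ⟩
    ind (toℕ v ≤ᵇ t) +ℕ gain (k v) (A ∪ ⁅ e ⁆) z′  ∎
    where
    open ≡-Reasoning
    z = override A y (x [ e ↦ v ])
    z′ = override (A ∪ ⁅ e ⁆) (y [ e ↦ v ]) x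
    ze : z e ≡ v
    ze = revealed-value A e y x v Ae
    z≗z′ : z ≗ z′
    z≗z′ = override-reveal A e y x v Ae

  winProb-pick-fresh : ∀ e k A y j → e ∉ A →
    winProb (pick e k) A y (suc j) ≡
    sumFin (suc m) (λ v → p e v * (if toℕ v ≤ᵇ t then winProb (k v) (A ∪ ⁅ e ⁆) (y [ e ↦ v ]) j
                                                  else winProb (k v) (A ∪ ⁅ e ⁆) (y [ e ↦ v ]) (suc j)))
  winProb-pick-fresh e k A y j Ae =
    trans (Expect-condition p dist (wins-extensional (pick e k) A y (suc j)) e)
          (sumFin-cong (suc m) λ v → cong (p e v *_) (trans
            (Pr-cong p (λ x → trans (cong (suc j ≤ᵇ_) (gain-reveal e k A y x v Ae)) (suc≤ᵇind+ (toℕ v ≤ᵇ t) j _)))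
            (Pr-if p (toℕ v ≤ᵇ t) (wins (k v) (A ∪ ⁅ e ⁆) (y [ e ↦ v ]) j)
                                  (wins (k v) (A ∪ ⁅ e ⁆) (y [ e ↦ v ]) (suc j)))))

  winProb-pick-known : ∀ e k A y j → e ∈ A → winProb (pick e k) A y j ≡ winProb (k (y e)) A y j
  winProb-pick-known e k A y j Ae = Pr-cong p λ x → cong (j ≤ᵇ_) (begin
    gain (pick e k) A (override A y x)       ≡⟨ gain-pick-known e k A (override A y x) Ae ⟩
    gain (k (override A y x e)) A (override A y x) ≡⟨ cong (λ w → gain (k w) A (override A y x)) (override-known A y x Ae) ⟩
    gain (k (y e)) A (override A y x)        ∎)
    where open ≡-Reasoning

  winProb-stop : ∀ A y j → winProb stop A y (suc j) ≡ 0ℚ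
  winProb-stop A y j =
    trans (Pr-cong p (λ x → cong (suc j ≤ᵇ_) (countNew-∅ _ A)))
          (Expect-const p dist 0ℚ)

  winProb-zero : ∀ π A y → winProb π A y 0 ≡ 1ℚ
  winProb-zero π A y = Expect-const p dist 1ℚ

  policy-bound : ∀ π A y B j → Dominates A B → All IsProb B →
                 (∀ x → I (A ∪ run π (override A y x))) → winProb π A y j ≤ tailProb B j
  policy-bound π A y B zero _ _ _ = ℚP.≤-reflexive (winProb-zero π A y)
  policy-bound stop A y B (suc j) _ B-probs _ =
    ℚP.≤-trans (ℚP.≤-reflexive (winProb-stop A y j)) (proj₁ (tailProb-isProb B-probs (suc j)))
  policy-bound (pick e k) A y B (suc j) dom B-probs indep with e ∈? A
  ... | yes Ae = ℚP.≤-trans (ℚP.≤-reflexive (winProb-pick-known e k A y (suc j) Ae))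
                          (policy-bound (k (y e)) A y B (suc j) dom B-probs indep′)
    where
    indep′ : ∀ x → I (A ∪ run (k (y e)) (override A y x))
    indep′ x = hereditary _ _ (∪-monoʳ-⊆ A (q⊆p∪q ⁅ e ⁆ _))
      (subst (λ w → I (A ∪ ⁅ e ⁆ ∪ run (k w) (override A y x))) (override-known A y x Ae) (indep x))
  ... | no Ae with dominates-extend {A} {B} dom Ae (hereditary _ _ (∪-monoʳ-⊆ A (p⊆p∪q _)) (indep (λ _ → zero)))
  ... | leastAbove L₁ b L₂ refl qe≤b _ , dom′ = begin
    winProb (pick e k) A y (suc j)
      ≡⟨ winProb-pick-fresh e k A y j Ae ⟩
    sumFin (suc m) (λ v → p e v * (if toℕ v ≤ᵇ t then P v j else P v (suc j)))
      ≤⟨ sumFin-mono (suc m) (λ v → *-monoˡ-≤-0≤ (proj₁ dist e v)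
           (if-mono (toℕ v ≤ᵇ t) (IH v j) (IH v (suc j)))) ⟩
    sumFin (suc m) (λ v → p e v * (if toℕ v ≤ᵇ t then tailProb B′ j else tailProb B′ (suc j)))
      ≡⟨ success-average e (tailProb B′ j) (tailProb B′ (suc j)) ⟩
    q e * tailProb B′ j + (1ℚ - q e) * tailProb B′ (suc j)
      ≤⟨ convex-weight-mono qe≤b (tailProb-antitone B′-probs j) ⟩
    b * tailProb B′ j + (1ℚ - b) * tailProb B′ (suc j)
      ≡⟨ tailProb-extract L₁ b L₂ (suc j) ⟨
    tailProb (L₁ ++ b ∷ L₂) (suc j) ∎
    where
    open ℚP.≤-Reasoning
    B′ = L₁ ++ L₂
    B′-probs : All IsProb B′
    B′-probs with ++⁻ L₁ B-probs
    ... | L₁-probs , _ ∷ L₂-probs = ++⁺ L₁-probs L₂-probs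
    P : Fin (suc m) → ℕ → ℚ
    P v = winProb (k v) (A ∪ ⁅ e ⁆) (y [ e ↦ v ])
    IH : ∀ v j → P v j ≤ tailProb B′ j
    IH v j = policy-bound (k v) (A ∪ ⁅ e ⁆) (y [ e ↦ v ]) B′ j dom′ B′-probs
               (λ x → subst I (run-reveal e k A y x v Ae) (indep (x [ e ↦ v ])))

  greedy-exact : ∀ {S G} (D : Greedy I q S G) y j →
                 winProb (pickAll (greedyPicks D)) S y j ≡ tailProb (greedyWeights D) j
  greedy-exact {S} D                  y zero    = winProb-zero (pickAll (greedyPicks D)) S y
  greedy-exact {S} (done _)           y (suc j) = winProb-stop S y j
  greedy-exact {S} (step e e∉S _ _ D) y (suc j) = begin
    winProb (pickAll (e ∷ greedyPicks D)) S y (suc j)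
      ≡⟨ winProb-pick-fresh e (λ _ → pickAll (greedyPicks D)) S y j e∉S ⟩
    sumFin (suc m) (λ v → p e v * (if toℕ v ≤ᵇ t then winProb (pickAll (greedyPicks D)) (S ∪ ⁅ e ⁆) (y [ e ↦ v ]) j
                                                  else winProb (pickAll (greedyPicks D)) (S ∪ ⁅ e ⁆) (y [ e ↦ v ]) (suc j)))
      ≡⟨ sumFin-cong (suc m) (λ v → cong (p e v *_)
           (cong₂ (λ P Q → if toℕ v ≤ᵇ t then P else Q)
                  (greedy-exact D (y [ e ↦ v ]) j) (greedy-exact D (y [ e ↦ v ]) (suc j)))) ⟩
    sumFin (suc m) (λ v → p e v * (if toℕ v ≤ᵇ t then tailProb (greedyWeights D) j else tailProb (greedyWeights D) (suc j)))
      ≡⟨ success-average e _ _ ⟩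
    tailProb (q e ∷ greedyWeights D) (suc j) ∎
    where open ≡-Reasoning

  rank-as-wins : ∀ π y j x → wins π ∅ y j x ≡ (j ≤ᵇ rankT t x (run π x))
  rank-as-wins π y j x = cong (j ≤ᵇ_) (begin
    gain π ∅ (override ∅ y x) ≡⟨ gain-cong π ∅ (λ d → cong (if_then y d else x d) (lookup-∅ d)) ⟩
    gain π ∅ x                ≡⟨ countNew-from-∅ (below x) (run π x) ⟩
    rankT t x (run π x)       ∎)
    where open ≡-Reasoning

-- The bound also holds for i = 0, where both sides are 1.
lemma6 : ∀ {n m : ℕ} (I : Subset n → Set) → IsMatroid I →
         (p : Fin n → Fin (suc m) → ℚ) → IsDistributions p → (t : ℕ) →
         (G : Subset n) → Greedy I (probLe p t) ∅ G →
         (i : ℕ) → 1 ≤ℕ i →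
         (π : Policy n m) → (∀ x → I (run π x)) →
         Pr p (λ x → i ≤ᵇ rankT t x (run π x)) ≤ Pr p (λ x → i ≤ᵇ rankT t x G)
lemma6 I matroid p dist t G D i _ π independent = begin
  Pr p (λ x → i ≤ᵇ rankT t x (run π x))
    ≡⟨ Pr-cong p (rank-as-wins π y₀ i) ⟨
  winProb π ∅ y₀ i
    ≤⟨ policy-bound π ∅ y₀ (greedyWeights D) i (greedy-dominates D) weights-are-probs independent-from-∅ ⟩
  tailProb (greedyWeights D) i
    ≡⟨ greedy-exact D y₀ i ⟨
  winProb (pickAll (greedyPicks D)) ∅ y₀ i
    ≡⟨ Pr-cong p greedy-wins ⟩
  Pr p (λ x → i ≤ᵇ rankT t x G) ∎
  where
  open ℚP.≤-Reasoning
  open Policies I matroid p dist t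
  open Dominance I matroid (probLe p t)
  y₀ : Outcome _ _
  y₀ _ = zero
  weights-are-probs : All IsProb (greedyWeights D)
  weights-are-probs = map⁺ (universal q-isProb (greedyPicks D))
  independent-from-∅ : ∀ x → I (∅ ∪ run π (override ∅ y₀ x))
  independent-from-∅ x = subst I (sym (∪-identityˡ _)) (independent (override ∅ y₀ x))
  greedy-wins : ∀ x → wins (pickAll (greedyPicks D)) ∅ y₀ i x ≡ (i ≤ᵇ rankT t x G)
  greedy-wins x = trans (rank-as-wins (pickAll (greedyPicks D)) y₀ i x)
                        (cong (λ S → i ≤ᵇ rankT t x S) (sym (trans (greedy-output D x) (∪-identityˡ _))))
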